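{- Let $\mathcal{L}$ be a finite meet-semilattice and let $$B^{\bullet}(\mathcal{L}) = \frac{\mathbb{Z}[h_x]_{x \in \mathcal{L}}}{((h_x - h_{x \wedge y})(h_y - h_{x \wedge y}) : x, y \in \mathcal{L})},$$ graded with each $h_x$ in degree $1$. Then $B^{\bullet}(\mathcal{L})$ is an algebra with straightening law over $\mathcal{L}$ (via $x \mapsto h_x$).
   Context: A finite meet-semilattice is a finite poset in which any two elements $x, y$ have a greatest lower bound $x \wedge y$; it has a minimal element $\hat{0}$. Let $B^{\bullet}$ be a graded algebra over a ring $R$ with $B^0 = R$, and $(\Pi, \le)$ a finite poset with an injection identifying $\Pi$ with a subset of $B^{\bullet}$ consisting of homogeneous elements of positive degree. $B^{\bullet}$ is an algebra with straightening law over $\Pi$ if (1) the standard monomials $\{y_1^{a_1} \dotsb y_k^{a_k} : y_1 \le \dotsb \le y_k \in \Pi\}$ form an $R$-basis of $B^{\bullet}$, and (2) for all incomparable $x, y \in \Pi$, when $xy = \sum a_\mu \mu$ is written in the standard monomial basis, every standard monomial $\mu$ with $a_\mu \neq 0$ contains a factor $z \in \Pi$ with $z < x$ and $z < y$. Here $R = \mathbb{Z}$. -}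

module Defs where

open import Level using (0ℓ)
open import Data.Nat using (ℕ; zero; suc) renaming (_<_ to _<ℕ_)
open import Data.Nat.Properties using (_≟_)
open import Data.Integer using (ℤ; 0ℤ; 1ℤ; -_) renaming (_+_ to _+ℤ_; _*_ to _*ℤ_)
open import Data.Fin using (Fin)
import Data.Fin as F
open import Data.Vec using (Vec; lookup; zipWith; replicate; tabulate)
open import Data.Vec.Properties using (≡-dec)
open import Data.List using (List; []; _∷_; map; concatMap; foldr; _++_)
open import Data.Product using (Σ; ∃; _×_; _,_)
open import Data.Sum using (_⊎_)
open import Relation.Binary.PropositionalEquality using (_≡_; _≢_)
open import Relation.Binary.Lattice.Structures using (IsMeetSemilattice)
open import Relation.Nullary using (¬_; yes; no)

record FiniteMeetSemilattice : Set₁ where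
  field
    n                 : ℕ
    _≤_               : Fin n → Fin n → Set
    _∧_               : Fin n → Fin n → Fin n
    isMeetSemilattice : IsMeetSemilattice _≡_ _≤_ _∧_

  _<_ : Fin n → Fin n → Set
  x < y = (x ≤ y) × (x ≢ y)

-- The polynomial ring ℤ[h_x : x ∈ Fin n].
-- A monomial is an exponent vector; a polynomial is a finite formal
-- ℤ-linear combination of monomials (a list of terms), compared by
-- coefficients.

Monomial : ℕ → Set
Monomial n = Vec ℕ n

_·ₘ_ : ∀ {n} → Monomial n → Monomial n → Monomial n
_·ₘ_ = zipWith Data.Nat._+_

varₘ : ∀ {n} → Fin n → Monomial n
varₘ x = tabulate (λ y → Data.Bool.if ⌊ x F.≟ y ⌋ then 1 else 0)
  where open import Relation.Nullary.Decidable using (⌊_⌋)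
        import Data.Bool

Poly : ℕ → Set
Poly n = List (ℤ × Monomial n)

coeff : ∀ {n} → Poly n → Monomial n → ℤ
coeff [] m = 0ℤ
coeff ((c , μ) ∷ p) m with ≡-dec _≟_ μ m
... | yes _ = c +ℤ coeff p m
... | no  _ = coeff p m

_≃_ : ∀ {n} → Poly n → Poly n → Set
p ≃ q = ∀ m → coeff p m ≡ coeff q m

0P : ∀ {n} → Poly n
0P = []

_+P_ : ∀ {n} → Poly n → Poly n → Poly n
_+P_ = _++_

-P_ : ∀ {n} → Poly n → Poly n
-P p = map (λ { (c , μ) → (- c , μ) }) p

_−P_ : ∀ {n} → Poly n → Poly n → Poly n
p −P q = p +P (-P q)

_*P_ : ∀ {n} → Poly n → Poly n → Poly n
p *P q = concatMap (λ { (c , μ) → map (λ { (d , ν) → (c *ℤ d , μ ·ₘ ν) }) q }) p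

sumP : ∀ {n} → List (Poly n) → Poly n
sumP = foldr _+P_ 0P

h : ∀ {n} → Fin n → Poly n
h x = (1ℤ , varₘ x) ∷ []

module _ (L : FiniteMeetSemilattice) where
  open FiniteMeetSemilattice L

  gen : Fin n → Fin n → Poly n
  gen x y = (h x −P h (x ∧ y)) *P (h y −P h (x ∧ y))

  InIdeal : Poly n → Set
  InIdeal p = Σ (List (Poly n × Fin n × Fin n)) λ cs →
                p ≃ sumP (map (λ { (q , x , y) → q *P gen x y }) cs)

  Contains : Monomial n → Fin n → Set
  Contains μ z = 0 <ℕ lookup μ z

  -- standard monomial h_{y1}^{a1}⋯h_{yk}^{ak} with y1 ≤ ⋯ ≤ yk:
  -- its support is a chain of L
  Standard : Monomial n → Set
  Standard μ = ∀ x y → Contains μ x → Contains μ y → (x ≤ y) ⊎ (y ≤ x)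

  StandardCombination : Poly n → Set
  StandardCombination p = ∀ μ → coeff p μ ≢ 0ℤ → Standard μ

  record IsASL : Set where
    field
      spanning     : ∀ (p : Poly n) → Σ (Poly n) λ q →
                       StandardCombination q × InIdeal (p −P q)
      independent  : ∀ (q : Poly n) → StandardCombination q →
                       InIdeal q → q ≃ 0P
      straightening : ∀ x y → ¬ (x ≤ y) → ¬ (y ≤ x) →
                       Σ (Poly n) λ q →
                         StandardCombination q ×
                         InIdeal ((h x *P h y) −P q) ×
                         (∀ μ → coeff q μ ≢ 0ℤ →
                            ∃ λ z → Contains μ z × z < x × z < y)

-- Spanning: if the support of a monomial is not a chain, it contains h_x h_y with x, y
-- incomparable, and modulo the generator (h_x - h_z)(h_y - h_z), where z = x ∧ y,
-- h_x h_y ≡ h_x h_z + h_z h_y - h_z h_z.  As z < x and z < y, each new monomial is strictly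
-- lighter for the weight Σ_x μ_x |↓x|, so repeated rewriting ends in a standard combination;
-- a single rewriting step of h_x h_y is the straightening law.
--
-- Independence: let μ be a standard monomial whose support is the chain C, and let floor x
-- be the largest element of C below x, or a new bottom element if there is none.  Since
-- floor (x ∧ y) is floor x or floor y, the substitution h_x ↦ h_(floor x) kills every
-- generator, hence the ideal, and so does the functional summing the coefficients over the
-- fibre of μ.  The substitution makes a monomial strictly lighter unless it fixes all its
-- variables, so μ is the only monomial in its fibre of weight at most that of μ; on a
-- standard combination in the ideal whose heaviest monomial is μ, the functional therefore
-- returns the coefficient of μ, which must vanish.

module Submission where

open import Defs

open import Data.Bool using (true; if_then_else_)
open import Data.Empty using (⊥-elim)
open import Data.Fin using (Fin; zero; suc; punchIn)
open import Data.Fin.Properties using (punchInᵢ≢i; any?) renaming (_≟_ to _≟ᶠ_)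
open import Data.Fin.Subset using (Subset; ∣_∣) renaming (_∈_ to _∈ₛ_)
open import Data.Fin.Subset.Properties using (p⊂q⇒∣p∣<∣q∣; ∣⊥∣≡0; ⊥⊆; ∉⊥)
open import Data.Integer as ℤ using (ℤ; 0ℤ; 1ℤ; -_) renaming (_+_ to _+ℤ_; _*_ to _*ℤ_; _-_ to _-ℤ_)
import Data.Integer.Properties as ℤP
open import Data.Integer.Tactic.RingSolver using (solve-∀)
open import Data.List using (List; []; _∷_; _++_; map; length; filter; allFin)
open import Data.List.Extrema.Nat using (argmax; argmax-all; f[xs]≤f[argmax])
open import Data.List.Membership.Propositional using (_∈_)
open import Data.List.Membership.Propositional.Properties using (∈-filter⁺; ∈-allFin)
open import Data.List.Properties using (++-identityʳ)
open import Data.List.Relation.Unary.All as All using (All; []; _∷_)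
open import Data.List.Relation.Unary.All.Properties using (all-filter; map⁺; ++⁺)
open import Data.List.Relation.Unary.Any using (here; there)
open import Data.Nat as ℕ using (ℕ; zero; suc; z≤n; s≤s; _∸_)
  renaming (_≤_ to _≤ℕ_; _<_ to _<ℕ_; _+_ to _+ℕ_; _*_ to _*ℕ_; _<?_ to _<?ℕ_)
open import Data.Nat.Induction using (<-wellFounded)
import Data.Nat.Properties as ℕP
open import Data.Product using (Σ; ∃; ∃₂; _×_; _,_; proj₁; proj₂)
open import Data.Sum as Sum using (_⊎_; inj₁; inj₂)
open import Data.Vec using ([]; _∷_; lookup; tabulate; replicate)
open import Data.Vec.Properties
  using (≡-dec; ∷-injectiveʳ; zipWith-identityˡ; lookup-zipWith; lookup∘tabulate; tabulate∘lookup; tabulate-cong;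
         lookup⇒[]=; []=⇒lookup)
open import Data.Vec.Relation.Binary.Pointwise.Extensional using (ext; Pointwise-≡⇒≡)
open import Function using (_∘_)
open import Induction.WellFounded using (Acc; acc)
open import Relation.Binary using (Reflexive; Transitive; IsPartialOrder) renaming (Decidable to Decidable₂)
open import Relation.Binary.Lattice using (IsMeetSemilattice)
open import Relation.Binary.PropositionalEquality
  using (_≡_; _≢_; refl; sym; trans; cong; cong₂; subst; subst₂; module ≡-Reasoning)
open import Relation.Nullary using (¬_; ¬?; yes; no)
open import Relation.Nullary.Decidable using (Dec; does; ⌊_⌋; ⌊⌋-map′; dec-true; map′; _×-dec_)
open import Relation.Unary using (Decidable)

open import Algebra.Properties.Semiring.Sum ℕP.+-*-semiring
  using (sum; sum-cong-≗; sum-remove; sum-replicate-zero; ∑-distrib-+; ∑-comm; *-distribˡ-sum; *-distribʳ-sum)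

sum-mono-≤ : ∀ {n} {f g : Fin n → ℕ} → (∀ i → f i ≤ℕ g i) → sum f ≤ℕ sum g
sum-mono-≤ {zero}  f≤g = z≤n
sum-mono-≤ {suc n} f≤g = ℕP.+-mono-≤ (f≤g zero) (sum-mono-≤ (f≤g ∘ suc))

sum-mono-< : ∀ {n} {f g : Fin n → ℕ} → (∀ i → f i ≤ℕ g i) → ∀ i → f i <ℕ g i → sum f <ℕ sum g
sum-mono-< {suc n} {f} {g} f≤g i fi<gi = begin-strict
  sum f                       ≡⟨ sum-remove {i = i} f ⟩
  f i +ℕ sum (f ∘ punchIn i)  <⟨ ℕP.+-mono-<-≤ fi<gi (sum-mono-≤ (f≤g ∘ punchIn i)) ⟩
  g i +ℕ sum (g ∘ punchIn i)  ≡⟨ sum-remove {i = i} g ⟨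
  sum g                       ∎
  where open ℕP.≤-Reasoning

sum-single : ∀ {n} (f : Fin n → ℕ) i → (∀ j → j ≢ i → f j ≡ 0) → sum f ≡ f i
sum-single {suc n} f i f≡0 = begin
  sum f                       ≡⟨ sum-remove {i = i} f ⟩
  f i +ℕ sum (f ∘ punchIn i)  ≡⟨ cong (f i +ℕ_) (sum-cong-≗ {n} λ j → f≡0 (punchIn i j) (punchInᵢ≢i i j)) ⟩
  f i +ℕ sum {n} (λ _ → 0)    ≡⟨ cong (f i +ℕ_) (sum-replicate-zero n) ⟩
  f i +ℕ 0                    ≡⟨ ℕP.+-identityʳ (f i) ⟩
  f i                         ∎
  where open ≡-Reasoning

module Monomials where
  private variable n m : ℕ

  lookup-varₘ-self : ∀ (x : Fin n) → lookup (varₘ x) x ≡ 1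
  lookup-varₘ-self x rewrite lookup∘tabulate (λ y → if ⌊ x ≟ᶠ y ⌋ then 1 else 0) x with x ≟ᶠ x
  ... | yes _   = refl
  ... | no x≢x = ⊥-elim (x≢x refl)

  lookup-varₘ-other : ∀ {x y : Fin n} → x ≢ y → lookup (varₘ x) y ≡ 0
  lookup-varₘ-other {x = x} {y} x≢y rewrite lookup∘tabulate (λ y → if ⌊ x ≟ᶠ y ⌋ then 1 else 0) y with x ≟ᶠ y
  ... | yes x≡y = ⊥-elim (x≢y x≡y)
  ... | no _    = refl

  varₘ-suc : ∀ (x : Fin n) → varₘ (suc x) ≡ 0 ∷ varₘ x
  varₘ-suc x = cong (0 ∷_) (tabulate-cong λ y → cong (if_then 1 else 0) (⌊⌋-map′ _ _ (x ≟ᶠ y)))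

  ·ₘ-identityˡ : ∀ (ν : Monomial n) → replicate n 0 ·ₘ ν ≡ ν
  ·ₘ-identityˡ = zipWith-identityˡ ℕP.+-identityˡ

  _·ₘ[_,_] : Monomial n → Fin n → Fin n → Monomial n
  μ ·ₘ[ a , b ] = μ ·ₘ (varₘ a ·ₘ varₘ b)

  lookup-varₘ² : ∀ (a b w : Fin n) → lookup (varₘ a ·ₘ varₘ b) w ≡ lookup (varₘ a) w +ℕ lookup (varₘ b) w
  lookup-varₘ² a b w = lookup-zipWith _+ℕ_ w (varₘ a) (varₘ b)

  support-varₘ² : ∀ {a b w : Fin n} → 0 <ℕ lookup (varₘ a ·ₘ varₘ b) w → w ≡ a ⊎ w ≡ b
  support-varₘ² {a = a} {b} {w} w∈supp with a ≟ᶠ w | b ≟ᶠ w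
  ... | yes a≡w | _       = inj₁ (sym a≡w)
  ... | no _    | yes b≡w = inj₂ (sym b≡w)
  ... | no a≢w  | no b≢w  = ⊥-elim (ℕP.<-irrefl refl (subst (0 <ℕ_) lookup≡0 w∈supp))
    where
    lookup≡0 = trans (lookup-varₘ² a b w) (cong₂ _+ℕ_ (lookup-varₘ-other a≢w) (lookup-varₘ-other b≢w))

  varₘ²-containsˡ : ∀ (a b : Fin n) → 0 <ℕ lookup (varₘ a ·ₘ varₘ b) a
  varₘ²-containsˡ a b rewrite lookup-varₘ² a b a | lookup-varₘ-self a = s≤s z≤n

  varₘ²-containsʳ : ∀ (a b : Fin n) → 0 <ℕ lookup (varₘ a ·ₘ varₘ b) b
  varₘ²-containsʳ a b rewrite lookup-varₘ² a b b | lookup-varₘ-self b = ℕP.<-≤-trans (s≤s z≤n) (ℕP.m≤n+m 1 _)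

  divide-varₘ² : ∀ {μ : Monomial n} {x y} → 0 <ℕ lookup μ x → 0 <ℕ lookup μ y → x ≢ y →
                 ∃ λ μ′ → μ ≡ μ′ ·ₘ[ x , y ]
  divide-varₘ² {μ = μ} {x} {y} μ[x]>0 μ[y]>0 x≢y = μ′ , Pointwise-≡⇒≡ (ext λ w → sym (begin
    lookup (μ′ ·ₘ xy) w                      ≡⟨ lookup-zipWith _+ℕ_ w μ′ xy ⟩
    lookup μ′ w +ℕ lookup xy w               ≡⟨ cong (_+ℕ lookup xy w) (lookup∘tabulate _ w) ⟩
    lookup μ w ∸ lookup xy w +ℕ lookup xy w  ≡⟨ ℕP.m∸n+n≡m (xy≤μ w) ⟩
    lookup μ w                               ∎))
    where
    open ≡-Reasoning
    xy = varₘ x ·ₘ varₘ y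
    μ′ = tabulate λ w → lookup μ w ∸ lookup xy w
    xy≤μ : ∀ w → lookup xy w ≤ℕ lookup μ w
    xy≤μ w rewrite lookup-varₘ² x y w with x ≟ᶠ w | y ≟ᶠ w
    ... | yes refl | yes refl = ⊥-elim (x≢y refl)
    ... | yes refl | no y≢x   rewrite lookup-varₘ-self x | lookup-varₘ-other y≢x = μ[x]>0
    ... | no x≢y   | yes refl rewrite lookup-varₘ-other x≢y | lookup-varₘ-self y = μ[y]>0
    ... | no x≢w   | no y≢w   rewrite lookup-varₘ-other x≢w | lookup-varₘ-other y≢w = z≤n

  weight : (Fin n → ℕ) → Monomial n → ℕ
  weight G μ = sum λ x → lookup μ x *ℕ G x

  weight-cong-support : ∀ {G H : Fin n → ℕ} ν → (∀ x → 0 <ℕ lookup ν x → G x ≡ H x) →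
                        weight G ν ≡ weight H ν
  weight-cong-support {n = n} {G} {H} ν G≡H = sum-cong-≗ {n} termwise
    where
    termwise : ∀ x → lookup ν x *ℕ G x ≡ lookup ν x *ℕ H x
    termwise x with lookup ν x in ν[x]
    ... | zero  = refl
    ... | suc k = cong (suc k *ℕ_) (G≡H x (subst (0 <ℕ_) (sym ν[x]) (s≤s z≤n)))

  weight-zero : ∀ (ν : Monomial n) → weight (λ _ → 0) ν ≡ 0
  weight-zero {n = n} ν = trans (sum-cong-≗ {n} λ x → ℕP.*-zeroʳ (lookup ν x)) (sum-replicate-zero n)

  weight-· : ∀ (G : Fin n → ℕ) μ ν → weight G (μ ·ₘ ν) ≡ weight G μ +ℕ weight G ν
  weight-· {n = n} G μ ν =
    trans (sum-cong-≗ {n} termwise) (∑-distrib-+ (λ x → lookup μ x *ℕ G x) (λ x → lookup ν x *ℕ G x))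
    where
    termwise : ∀ x → lookup (μ ·ₘ ν) x *ℕ G x ≡ lookup μ x *ℕ G x +ℕ lookup ν x *ℕ G x
    termwise x = trans (cong (_*ℕ G x) (lookup-zipWith _+ℕ_ x μ ν)) (ℕP.*-distribʳ-+ (G x) (lookup μ x) (lookup ν x))

  weight-varₘ : ∀ (G : Fin n → ℕ) a → weight G (varₘ a) ≡ G a
  weight-varₘ G a = begin
    weight G (varₘ a)         ≡⟨ sum-single (λ x → lookup (varₘ a) x *ℕ G x) a
                                            (λ x x≢a → cong (_*ℕ G x) (lookup-varₘ-other (x≢a ∘ sym))) ⟩
    lookup (varₘ a) a *ℕ G a  ≡⟨ cong (_*ℕ G a) (lookup-varₘ-self a) ⟩
    1 *ℕ G a                  ≡⟨ ℕP.*-identityˡ (G a) ⟩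
    G a                       ∎
    where open ≡-Reasoning

  weight-coordinate : ∀ (ν : Monomial n) y → weight (λ x → lookup (varₘ x) y) ν ≡ lookup ν y
  weight-coordinate ν y = begin
    weight (λ x → lookup (varₘ x) y) ν  ≡⟨ sum-single (λ x → lookup ν x *ℕ lookup (varₘ x) y) y
                                                      (λ x x≢y → trans (cong (lookup ν x *ℕ_) (lookup-varₘ-other x≢y))
                                                                       (ℕP.*-zeroʳ (lookup ν x))) ⟩
    lookup ν y *ℕ lookup (varₘ y) y     ≡⟨ cong (lookup ν y *ℕ_) (lookup-varₘ-self y) ⟩
    lookup ν y *ℕ 1                     ≡⟨ ℕP.*-identityʳ (lookup ν y) ⟩
    lookup ν y                          ∎
    where open ≡-Reasoning

  weight-·ₘ[] : ∀ (G : Fin n → ℕ) μ a b → weight G (μ ·ₘ[ a , b ]) ≡ weight G μ +ℕ (G a +ℕ G b)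
  weight-·ₘ[] G μ a b = trans (weight-· G μ (varₘ a ·ₘ varₘ b)) (cong (weight G μ +ℕ_)
    (trans (weight-· G (varₘ a) (varₘ b)) (cong₂ _+ℕ_ (weight-varₘ G a) (weight-varₘ G b))))

  weight-·ₘ[]-< : ∀ (G : Fin n → ℕ) μ {a b a′ b′} → G a′ +ℕ G b′ <ℕ G a +ℕ G b →
                  weight G (μ ·ₘ[ a′ , b′ ]) <ℕ weight G (μ ·ₘ[ a , b ])
  weight-·ₘ[]-< G μ {a} {b} {a′} {b′} lt =
    subst₂ _<ℕ_ (sym (weight-·ₘ[] G μ a′ b′)) (sym (weight-·ₘ[] G μ a b)) (ℕP.+-monoʳ-< (weight G μ) lt)

  weight-< : ∀ {G H : Fin n → ℕ} ν x → (∀ y → G y ≤ℕ H y) → 0 <ℕ lookup ν x → G x <ℕ H x →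
             weight G ν <ℕ weight H ν
  weight-< ν x G≤H ν[x]>0 Gx<Hx = sum-mono-< (λ y → ℕP.*-monoʳ-≤ (lookup ν y) (G≤H y)) x
                                             (ℕP.*-monoʳ-< (lookup ν x) {{ℕ.>-nonZero ν[x]>0}} Gx<Hx)

  -- The substitution h_x ↦ h_(σ x): the exponent of h_j is the sum of the exponents of the h_x with σ x = j.
  rename : (Fin n → Fin m) → Monomial n → Monomial m
  rename σ ν = tabulate λ j → weight (λ x → lookup (varₘ (σ x)) j) ν

  private
    tabulate-+ : (f g : Fin m → ℕ) → tabulate (λ j → f j +ℕ g j) ≡ tabulate f ·ₘ tabulate g
    tabulate-+ {m = zero}  f g = refl
    tabulate-+ {m = suc m} f g = cong (f zero +ℕ g zero ∷_) (tabulate-+ (f ∘ suc) (g ∘ suc))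

  rename-· : ∀ (σ : Fin n → Fin m) μ ν → rename σ (μ ·ₘ ν) ≡ rename σ μ ·ₘ rename σ ν
  rename-· σ μ ν = trans (tabulate-cong λ j → weight-· _ μ ν) (tabulate-+ _ _)

  rename-varₘ : ∀ (σ : Fin n → Fin m) x → rename σ (varₘ x) ≡ varₘ (σ x)
  rename-varₘ σ x =
    trans (tabulate-cong λ j → weight-varₘ (λ y → lookup (varₘ (σ y)) j) x) (tabulate∘lookup (varₘ (σ x)))

  rename-·ₘ[] : ∀ (σ : Fin n → Fin m) μ a b → rename σ (μ ·ₘ[ a , b ]) ≡ rename σ μ ·ₘ[ σ a , σ b ]
  rename-·ₘ[] σ μ a b = trans (rename-· σ μ (varₘ a ·ₘ varₘ b)) (cong (rename σ μ ·ₘ_)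
    (trans (rename-· σ (varₘ a) (varₘ b)) (cong₂ _·ₘ_ (rename-varₘ σ a) (rename-varₘ σ b))))

  rename-·ₘ[]-cong : ∀ (σ : Fin n → Fin m) μ {a b a′ b′} → σ a ≡ σ a′ → σ b ≡ σ b′ →
                     rename σ (μ ·ₘ[ a , b ]) ≡ rename σ (μ ·ₘ[ a′ , b′ ])
  rename-·ₘ[]-cong σ μ {a} {b} {a′} {b′} σa≡σa′ σb≡σb′ =
    trans (rename-·ₘ[] σ μ a b)
          (trans (cong₂ (rename σ μ ·ₘ[_,_]) σa≡σa′ σb≡σb′) (sym (rename-·ₘ[] σ μ a′ b′)))

  rename-cong-support : ∀ {σ τ : Fin n → Fin m} ν → (∀ x → 0 <ℕ lookup ν x → σ x ≡ τ x) →
                        rename σ ν ≡ rename τ ν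
  rename-cong-support ν σ≡τ =
    tabulate-cong λ j → weight-cong-support ν λ x ν[x]>0 → cong (λ a → lookup (varₘ a) j) (σ≡τ x ν[x]>0)

  rename-suc : ∀ (ν : Monomial n) → rename suc ν ≡ 0 ∷ ν
  rename-suc {n = n} ν = begin
    rename suc ν
      ≡⟨ tabulate-cong (λ j → sum-cong-≗ {n} λ x → cong (λ v → lookup ν x *ℕ lookup v j) (varₘ-suc x)) ⟩
    weight (λ _ → 0) ν ∷ tabulate (λ j → weight (λ x → lookup (varₘ x) j) ν)
      ≡⟨ cong₂ _∷_ (weight-zero ν) (trans (tabulate-cong (weight-coordinate ν)) (tabulate∘lookup ν)) ⟩
    0 ∷ ν
      ∎
    where open ≡-Reasoning

  weight-rename : ∀ (σ : Fin n → Fin m) G ν → weight G (rename σ ν) ≡ weight (G ∘ σ) ν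
  weight-rename {n = n} {m = m} σ G ν = begin
    weight G (rename σ ν)
      ≡⟨ sum-cong-≗ {m} (λ j → cong (_*ℕ G j) (lookup∘tabulate _ j)) ⟩
    sum (λ j → sum (λ x → lookup ν x *ℕ e x j) *ℕ G j)
      ≡⟨ sum-cong-≗ {m} (λ j → *-distribʳ-sum (G j) (λ x → lookup ν x *ℕ e x j)) ⟩
    sum (λ j → sum (λ x → lookup ν x *ℕ e x j *ℕ G j))
      ≡⟨ ∑-comm (λ j x → lookup ν x *ℕ e x j *ℕ G j) ⟩
    sum (λ x → sum (λ j → lookup ν x *ℕ e x j *ℕ G j))
      ≡⟨ sum-cong-≗ {n} (λ x → trans (sum-cong-≗ {m} λ j → ℕP.*-assoc (lookup ν x) (e x j) (G j))
                                     (sym (*-distribˡ-sum (lookup ν x) (λ j → e x j *ℕ G j)))) ⟩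
    sum (λ x → lookup ν x *ℕ weight G (varₘ (σ x)))
      ≡⟨ sum-cong-≗ {n} (λ x → cong (lookup ν x *ℕ_) (weight-varₘ G (σ x))) ⟩
    weight (G ∘ σ) ν
      ∎
    where
    open ≡-Reasoning
    e : Fin n → Fin m → ℕ
    e x j = lookup (varₘ (σ x)) j

module Polynomials where
  private variable n : ℕ

  Λ : (Monomial n → ℤ) → Poly n → ℤ
  Λ F []            = 0ℤ
  Λ F ((c , μ) ∷ p) = c *ℤ F μ +ℤ Λ F p

  Λ-++ : ∀ (F : Monomial n → ℤ) p q → Λ F (p ++ q) ≡ Λ F p +ℤ Λ F q
  Λ-++ F []            q = sym (ℤP.+-identityˡ (Λ F q))
  Λ-++ F ((c , μ) ∷ p) q = trans (cong (c *ℤ F μ +ℤ_) (Λ-++ F p q)) (sym (ℤP.+-assoc (c *ℤ F μ) (Λ F p) (Λ F q)))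

  Λ-neg : ∀ (F : Monomial n → ℤ) p → Λ F (-P p) ≡ - Λ F p
  Λ-neg F []            = refl
  Λ-neg F ((c , μ) ∷ p) =
    trans (cong₂ _+ℤ_ (sym (ℤP.neg-distribˡ-* c (F μ))) (Λ-neg F p)) (sym (ℤP.neg-distrib-+ (c *ℤ F μ) (Λ F p)))

  Λ-−P : ∀ (F : Monomial n → ℤ) p q → Λ F (p −P q) ≡ Λ F p -ℤ Λ F q
  Λ-−P F p q = trans (Λ-++ F p (-P q)) (cong (Λ F p +ℤ_) (Λ-neg F q))

  indicator : Monomial n → Monomial n → ℤ
  indicator m μ = if ⌊ ≡-dec ℕP._≟_ μ m ⌋ then 1ℤ else 0ℤ

  Λ-indicator : ∀ (p : Poly n) m → Λ (indicator m) p ≡ coeff p m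
  Λ-indicator []            m = refl
  Λ-indicator ((c , μ) ∷ p) m with ≡-dec ℕP._≟_ μ m
  ... | yes _ = cong₂ _+ℤ_ (ℤP.*-identityʳ c) (Λ-indicator p m)
  ... | no _  = trans (cong (_+ℤ Λ (indicator m) p) (ℤP.*-zeroʳ c)) (trans (ℤP.+-identityˡ _) (Λ-indicator p m))

  Λ-ext : ∀ (p q : Poly n) → (∀ F → Λ F p ≡ Λ F q) → p ≃ q
  Λ-ext p q Λp≡Λq m = trans (sym (Λ-indicator p m)) (trans (Λp≡Λq (indicator m)) (Λ-indicator q m))

  without : Monomial n → Poly n → Poly n
  without μ []            = []
  without μ ((c , ν) ∷ p) with ≡-dec ℕP._≟_ ν μ
  ... | yes _ = without μ p
  ... | no _  = (c , ν) ∷ without μ p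

  Λ-without : ∀ (F : Monomial n → ℤ) μ p → Λ F p ≡ coeff p μ *ℤ F μ +ℤ Λ F (without μ p)
  Λ-without F μ []            = sym (ℤP.*-zeroˡ (F μ))
  Λ-without F μ ((c , ν) ∷ p) with ≡-dec ℕP._≟_ ν μ
  ... | yes refl = trans (cong (c *ℤ F ν +ℤ_) (Λ-without F ν p)) (regroup c (F ν) (coeff p ν) (Λ F (without ν p)))
    where
    regroup : ∀ c f d r → c *ℤ f +ℤ (d *ℤ f +ℤ r) ≡ (c +ℤ d) *ℤ f +ℤ r
    regroup = solve-∀
  ... | no _     =
    trans (cong (c *ℤ F ν +ℤ_) (Λ-without F μ p)) (swap (c *ℤ F ν) (coeff p μ *ℤ F μ) (Λ F (without μ p)))
    where
    swap : ∀ a b r → a +ℤ (b +ℤ r) ≡ b +ℤ (a +ℤ r)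
    swap = solve-∀

  coeff-without-self : ∀ μ (p : Poly n) → coeff (without μ p) μ ≡ 0ℤ
  coeff-without-self μ []            = refl
  coeff-without-self μ ((c , ν) ∷ p) with ≡-dec ℕP._≟_ ν μ
  ... | yes _   = coeff-without-self μ p
  ... | no ν≢μ with ≡-dec ℕP._≟_ ν μ
  ...   | yes ν≡μ = ⊥-elim (ν≢μ ν≡μ)
  ...   | no _    = coeff-without-self μ p

  coeff-without-other : ∀ {μ ν} (p : Poly n) → ν ≢ μ → coeff (without μ p) ν ≡ coeff p ν
  coeff-without-other         []            ν≢μ = refl
  coeff-without-other {μ = μ} {ν} ((c , κ) ∷ p) ν≢μ with ≡-dec ℕP._≟_ κ μ
  ... | yes refl with ≡-dec ℕP._≟_ κ ν
  ...   | yes refl = ⊥-elim (ν≢μ refl)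
  ...   | no _     = coeff-without-other p ν≢μ
  coeff-without-other {μ = μ} {ν} ((c , κ) ∷ p) ν≢μ | no _ with ≡-dec ℕP._≟_ κ ν
  ...   | yes _ = cong (c +ℤ_) (coeff-without-other p ν≢μ)
  ...   | no _  = coeff-without-other p ν≢μ

  length-without : ∀ μ (p : Poly n) → length (without μ p) ≤ℕ length p
  length-without μ []            = z≤n
  length-without μ ((c , ν) ∷ p) with ≡-dec ℕP._≟_ ν μ
  ... | yes _ = ℕP.m≤n⇒m≤1+n (length-without μ p)
  ... | no _  = s≤s (length-without μ p)

  length-without-head : ∀ c μ (p : Poly n) → length (without μ ((c , μ) ∷ p)) ≤ℕ length p
  length-without-head c μ p with ≡-dec ℕP._≟_ μ μ
  ... | yes _   = length-without μ p
  ... | no μ≢μ = ⊥-elim (μ≢μ refl)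

  Λ-cong-termwise : ∀ {F G : Monomial n → ℤ} p q → (∀ ν → coeff p ν *ℤ F ν ≡ coeff q ν *ℤ G ν) →
                    Λ F p ≡ Λ G q
  Λ-cong-termwise {F = F} {G} p q = go (length p +ℕ length q) p q ℕP.≤-refl
    where
    go : ∀ k p q → length p +ℕ length q ≤ℕ k →
         (∀ ν → coeff p ν *ℤ F ν ≡ coeff q ν *ℤ G ν) → Λ F p ≡ Λ G q
    drop : ∀ k μ p q → length (without μ p) +ℕ length (without μ q) ≤ℕ k →
           (∀ ν → coeff p ν *ℤ F ν ≡ coeff q ν *ℤ G ν) → Λ F p ≡ Λ G q

    go _       []               []               _       _ = refl
    go (suc k) p@((c , μ) ∷ p′) q                (s≤s ℓ) e =
      drop k μ p q (ℕP.≤-trans (ℕP.+-mono-≤ (length-without-head c μ p′) (length-without μ q)) ℓ) e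
    go (suc k) []               q@((c , μ) ∷ q′) (s≤s ℓ) e =
      drop k μ [] q (ℕP.≤-trans (length-without-head c μ q′) ℓ) e

    drop k μ p q ℓ e = begin
      Λ F p                                  ≡⟨ Λ-without F μ p ⟩
      coeff p μ *ℤ F μ +ℤ Λ F (without μ p)  ≡⟨ cong₂ _+ℤ_ (e μ) (go k (without μ p) (without μ q) ℓ e′) ⟩
      coeff q μ *ℤ G μ +ℤ Λ G (without μ q)  ≡⟨ Λ-without G μ q ⟨
      Λ G q                                  ∎
      where
      open ≡-Reasoning
      e′ : ∀ ν → coeff (without μ p) ν *ℤ F ν ≡ coeff (without μ q) ν *ℤ G ν
      e′ ν with ≡-dec ℕP._≟_ ν μ
      ... | yes refl rewrite coeff-without-self ν p | coeff-without-self ν q = refl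
      ... | no ν≢μ  rewrite coeff-without-other p ν≢μ | coeff-without-other q ν≢μ = e ν

  Λ-cong : ∀ (F : Monomial n → ℤ) p q → p ≃ q → Λ F p ≡ Λ F q
  Λ-cong F p q p≃q = Λ-cong-termwise p q λ ν → cong (_*ℤ F ν) (p≃q ν)

  Λ-cong-support : ∀ {F G : Monomial n → ℤ} p → (∀ ν → coeff p ν ≢ 0ℤ → F ν ≡ G ν) → Λ F p ≡ Λ G p
  Λ-cong-support {F = F} {G} p F≡G = Λ-cong-termwise p p termwise
    where
    termwise : ∀ ν → coeff p ν *ℤ F ν ≡ coeff p ν *ℤ G ν
    termwise ν with coeff p ν ℤ.≟ 0ℤ
    ... | yes p[ν]≡0 rewrite p[ν]≡0 = refl
    ... | no p[ν]≢0  = cong (coeff p ν *ℤ_) (F≡G ν p[ν]≢0)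

  coeff≢0⇒∈ : ∀ (p : Poly n) {μ} → coeff p μ ≢ 0ℤ → μ ∈ map proj₂ p
  coeff≢0⇒∈ []                p[μ]≢0 = ⊥-elim (p[μ]≢0 refl)
  coeff≢0⇒∈ ((c , ν) ∷ p) {μ} p[μ]≢0 with ≡-dec ℕP._≟_ ν μ
  ... | yes ν≡μ = here (sym ν≡μ)
  ... | no _    = there (coeff≢0⇒∈ p p[μ]≢0)

  All-support : ∀ {P : Monomial n → Set} {p : Poly n} → All (P ∘ proj₂) p → ∀ μ → coeff p μ ≢ 0ℤ → P μ
  All-support {p = p} Pp μ p[μ]≢0 = All.lookup (map⁺ Pp) (coeff≢0⇒∈ p p[μ]≢0)

  heaviest-term : ∀ (w : Monomial n → ℕ) (p : Poly n) {m} → coeff p m ≢ 0ℤ →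
                  ∃ λ μ → coeff p μ ≢ 0ℤ × (∀ ν → coeff p ν ≢ 0ℤ → w ν ≤ℕ w μ)
  heaviest-term w p {m} p[m]≢0 =
    argmax w m support ,
    argmax-all w p[m]≢0 (all-filter nonzero? (map proj₂ p)) ,
    λ ν p[ν]≢0 → All.lookup (f[xs]≤f[argmax] m support) (∈-filter⁺ nonzero? (coeff≢0⇒∈ p p[ν]≢0) p[ν]≢0)
    where
    nonzero? : Decidable (λ ν → coeff p ν ≢ 0ℤ)
    nonzero? ν = ¬? (coeff p ν ℤ.≟ 0ℤ)
    support = filter nonzero? (map proj₂ p)

open Monomials
open Polynomials

module _ {A : Set} {_≤_ : A → A → Set} (≤-refl : Reflexive _≤_) (≤-trans : Transitive _≤_)
         {P : A → Set} (P? : Decidable P) (comparable : ∀ {a b} → P a → P b → a ≤ b ⊎ b ≤ a) where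

  greatest : ∀ xs → All (¬_ ∘ P) xs ⊎ ∃ λ m → P m × All (λ s → P s → s ≤ m) xs
  greatest []       = inj₁ []
  greatest (a ∷ xs) with P? a | greatest xs
  ... | no ¬Pa | inj₁ none          = inj₁ (¬Pa ∷ none)
  ... | no ¬Pa | inj₂ (m , Pm , up) = inj₂ (m , Pm , (λ Pa → ⊥-elim (¬Pa Pa)) ∷ up)
  ... | yes Pa | inj₁ none          = inj₂ (a , Pa , (λ _ → ≤-refl) ∷ All.map (λ ¬Ps Ps → ⊥-elim (¬Ps Ps)) none)
  ... | yes Pa | inj₂ (m , Pm , up) with comparable Pa Pm
  ...   | inj₁ a≤m = inj₂ (m , Pm , (λ _ → a≤m) ∷ up)
  ...   | inj₂ m≤a = inj₂ (a , Pa , (λ _ → ≤-refl) ∷ All.map (λ s≤m Ps → ≤-trans (s≤m Ps) m≤a) up)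

module DownSetRank {n : ℕ} {_≤_ : Fin n → Fin n → Set}
                   (isPartialOrder : IsPartialOrder _≡_ _≤_) (_≤?_ : Decidable₂ _≤_) where
  open IsPartialOrder isPartialOrder using (antisym) renaming (refl to ≤-refl; trans to ≤-trans)

  ↓_ : Fin n → Subset n
  ↓ x = tabulate λ w → does (w ≤? x)

  ∈↓⁺ : ∀ {w x} → w ≤ x → w ∈ₛ ↓ x
  ∈↓⁺ {w} {x} w≤x = lookup⇒[]= w (↓ x) (trans (lookup∘tabulate _ w) (dec-true (w ≤? x) w≤x))

  ∈↓⁻ : ∀ {w x} → w ∈ₛ ↓ x → w ≤ x
  ∈↓⁻ {w} {x} w∈↓x = from-does (w ≤? x) (trans (sym (lookup∘tabulate _ w)) ([]=⇒lookup w∈↓x))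
    where
    from-does : (d : Dec (w ≤ x)) → does d ≡ true → w ≤ x
    from-does (yes w≤x) _ = w≤x
    from-does (no _)    ()

  rank : Fin n → ℕ
  rank x = ∣ ↓ x ∣

  rank-pos : ∀ x → 0 <ℕ rank x
  rank-pos x = subst (_<ℕ rank x) (∣⊥∣≡0 n) (p⊂q⇒∣p∣<∣q∣ (⊥⊆ , x , ∈↓⁺ ≤-refl , ∉⊥))

  rank-strict : ∀ {x y} → x ≤ y → x ≢ y → rank x <ℕ rank y
  rank-strict {x} {y} x≤y x≢y =
    p⊂q⇒∣p∣<∣q∣ (↓x⊆↓y , y , ∈↓⁺ ≤-refl , λ y∈↓x → x≢y (antisym x≤y (∈↓⁻ y∈↓x)))
    where
    ↓x⊆↓y : ∀ {w} → w ∈ₛ ↓ x → w ∈ₛ ↓ y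
    ↓x⊆↓y w∈↓x = ∈↓⁺ (≤-trans (∈↓⁻ w∈↓x) x≤y)

module AlgebraWithStraighteningLaw (L : FiniteMeetSemilattice) where
  open FiniteMeetSemilattice L
  open IsMeetSemilattice isMeetSemilattice
    using (isPartialOrder; x∧y≤x; x∧y≤y; ∧-greatest; antisym) renaming (refl to ≤-refl; trans to ≤-trans)

  _≤?_ : Decidable₂ _≤_
  x ≤? y = map′ (λ x∧y≡x → subst (_≤ y) x∧y≡x (x∧y≤y x y))
                (λ x≤y → antisym (x∧y≤x x y) (∧-greatest ≤-refl x≤y))
                ((x ∧ y) ≟ᶠ x)

  open DownSetRank isPartialOrder _≤?_ using (rank; rank-pos; rank-strict)

  meet-<ˡ : ∀ {x y} → ¬ x ≤ y → (x ∧ y) < x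
  meet-<ˡ {x} {y} x≰y = x∧y≤x x y , λ x∧y≡x → x≰y (subst (_≤ y) x∧y≡x (x∧y≤y x y))

  meet-<ʳ : ∀ {x y} → ¬ y ≤ x → (x ∧ y) < y
  meet-<ʳ {x} {y} y≰x = x∧y≤y x y , λ x∧y≡y → y≰x (subst (_≤ x) x∧y≡y (x∧y≤x x y))

  rank-meet-<ˡ : ∀ {x y} → ¬ x ≤ y → rank (x ∧ y) <ℕ rank x
  rank-meet-<ˡ x≰y = let x∧y≤x , x∧y≢x = meet-<ˡ x≰y in rank-strict x∧y≤x x∧y≢x

  rank-meet-<ʳ : ∀ {x y} → ¬ y ≤ x → rank (x ∧ y) <ℕ rank y
  rank-meet-<ʳ y≰x = let x∧y≤y , x∧y≢y = meet-<ʳ y≰x in rank-strict x∧y≤y x∧y≢y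

  standard-varₘ² : ∀ {a b} → a ≤ b ⊎ b ≤ a → Standard L (varₘ a ·ₘ varₘ b)
  standard-varₘ² {a} {b} a~b u v u∈ v∈ with support-varₘ² {a = a} {b} {u} u∈ | support-varₘ² {a = a} {b} {v} v∈
  ... | inj₁ refl | inj₁ refl = inj₁ ≤-refl
  ... | inj₁ refl | inj₂ refl = a~b
  ... | inj₂ refl | inj₁ refl = Sum.swap a~b
  ... | inj₂ refl | inj₂ refl = inj₁ ≤-refl

  comparable : ∀ x y → ¬ (¬ x ≤ y × ¬ y ≤ x) → x ≤ y ⊎ y ≤ x
  comparable x y not-incomparable with x ≤? y | y ≤? x
  ... | yes x≤y | _       = inj₁ x≤y
  ... | no _    | yes y≤x = inj₂ y≤x
  ... | no x≰y  | no y≰x  = ⊥-elim (not-incomparable (x≰y , y≰x))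

  incomparable-in? : ∀ μ x y → Dec (Contains L μ x × Contains L μ y × ¬ x ≤ y × ¬ y ≤ x)
  incomparable-in? μ x y = (0 <?ℕ lookup μ x) ×-dec (0 <?ℕ lookup μ y) ×-dec ¬? (x ≤? y) ×-dec ¬? (y ≤? x)

  standard-or-incomparable : ∀ μ → Standard L μ ⊎ ∃₂ λ x y → Contains L μ x × Contains L μ y × ¬ x ≤ y × ¬ y ≤ x
  standard-or-incomparable μ with any? (λ x → any? (λ y → incomparable-in? μ x y))
  ... | yes incomparable = inj₂ incomparable
  ... | no ∄incomparable = inj₁ λ x y μ[x]>0 μ[y]>0 →
    comparable x y λ (x≰y , y≰x) → ∄incomparable (x , y , μ[x]>0 , μ[y]>0 , x≰y , y≰x)

  combination : List (Poly n × Fin n × Fin n) → Poly n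
  combination cs = sumP (map (λ { (q , x , y) → q *P gen L x y }) cs)

  Λ-combination-++ : ∀ (F : Monomial n → ℤ) cs ds →
                     Λ F (combination (cs ++ ds)) ≡ Λ F (combination cs) +ℤ Λ F (combination ds)
  Λ-combination-++ F []                  ds = sym (ℤP.+-identityˡ (Λ F (combination ds)))
  Λ-combination-++ F ((q , x , y) ∷ cs) ds = begin
    Λ F (g ++ combination (cs ++ ds))      ≡⟨ Λ-++ F g (combination (cs ++ ds)) ⟩
    Λ F g +ℤ Λ F (combination (cs ++ ds))  ≡⟨ cong (Λ F g +ℤ_) (Λ-combination-++ F cs ds) ⟩
    Λ F g +ℤ (Σcs +ℤ Σds)                  ≡⟨ ℤP.+-assoc (Λ F g) Σcs Σds ⟨
    Λ F g +ℤ Σcs +ℤ Σds                    ≡⟨ cong (_+ℤ Σds) (Λ-++ F g (combination cs)) ⟨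
    Λ F (g ++ combination cs) +ℤ Σds       ∎
    where
    open ≡-Reasoning
    g = q *P gen L x y
    Σcs = Λ F (combination cs)
    Σds = Λ F (combination ds)

  ideal-transport : ∀ p q → (∀ F → Λ F p ≡ Λ F q) → InIdeal L p → InIdeal L q
  ideal-transport p q Λp≡Λq (cs , p≃Σ) = cs , λ m → trans (sym (Λ-ext p q Λp≡Λq m)) (p≃Σ m)

  ideal-++ : ∀ {p q : Poly n} → InIdeal L p → InIdeal L q → InIdeal L (p ++ q)
  ideal-++ {p} {q} (cs , p≃Σ) (ds , q≃Σ) = cs ++ ds , Λ-ext (p ++ q) (combination (cs ++ ds)) λ F → begin
    Λ F (p ++ q)                                  ≡⟨ Λ-++ F p q ⟩
    Λ F p +ℤ Λ F q                                ≡⟨ cong₂ _+ℤ_ (Λ-cong F p (combination cs) p≃Σ)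
                                                                 (Λ-cong F q (combination ds) q≃Σ) ⟩
    Λ F (combination cs) +ℤ Λ F (combination ds)  ≡⟨ Λ-combination-++ F cs ds ⟨
    Λ F (combination (cs ++ ds))                  ∎
    where open ≡-Reasoning

  multiple∈ideal : ∀ q x y → InIdeal L (q *P gen L x y)
  multiple∈ideal q x y = (q , x , y) ∷ [] , λ m → cong (λ r → coeff r m) (sym (++-identityʳ (q *P gen L x y)))

  infix 4 _≈I_
  record _≈I_ (p q : Poly n) : Set where
    constructor congruent
    field difference∈ideal : InIdeal L (p −P q)

  ≈I-refl : ∀ p → p ≈I p
  ≈I-refl p = congruent (ideal-transport [] (p −P p) (λ F → sym (trans (Λ-−P F p p) (ℤP.+-inverseʳ (Λ F p))))
                                         ([] , λ _ → refl))

  ≈I-trans : ∀ {p q r} → p ≈I q → q ≈I r → p ≈I r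
  ≈I-trans {p} {q} {r} (congruent p−q∈I) (congruent q−r∈I) =
    congruent (ideal-transport ((p −P q) ++ (q −P r)) (p −P r) (λ F → begin
      Λ F ((p −P q) ++ (q −P r))            ≡⟨ Λ-++ F (p −P q) (q −P r) ⟩
      Λ F (p −P q) +ℤ Λ F (q −P r)          ≡⟨ cong₂ _+ℤ_ (Λ-−P F p q) (Λ-−P F q r) ⟩
      (Λ F p -ℤ Λ F q) +ℤ (Λ F q -ℤ Λ F r)  ≡⟨ telescope (Λ F p) (Λ F q) (Λ F r) ⟩
      Λ F p -ℤ Λ F r                        ≡⟨ Λ-−P F p r ⟨
      Λ F (p −P r)                          ∎) (ideal-++ {p −P q} {q −P r} p−q∈I q−r∈I))
    where
    open ≡-Reasoning
    telescope : ∀ a b c → (a -ℤ b) +ℤ (b -ℤ c) ≡ a -ℤ c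
    telescope = solve-∀

  ≈I-++ : ∀ {p q p′ q′} → p ≈I q → p′ ≈I q′ → (p ++ p′) ≈I (q ++ q′)
  ≈I-++ {p} {q} {p′} {q′} (congruent p−q∈I) (congruent p′−q′∈I) =
    congruent (ideal-transport ((p −P q) ++ (p′ −P q′)) ((p ++ p′) −P (q ++ q′)) (λ F → begin
      Λ F ((p −P q) ++ (p′ −P q′))            ≡⟨ Λ-++ F (p −P q) (p′ −P q′) ⟩
      Λ F (p −P q) +ℤ Λ F (p′ −P q′)          ≡⟨ cong₂ _+ℤ_ (Λ-−P F p q) (Λ-−P F p′ q′) ⟩
      (Λ F p -ℤ Λ F q) +ℤ (Λ F p′ -ℤ Λ F q′)  ≡⟨ interchange (Λ F p) (Λ F q) (Λ F p′) (Λ F q′) ⟩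
      (Λ F p +ℤ Λ F p′) -ℤ (Λ F q +ℤ Λ F q′)  ≡⟨ cong₂ _-ℤ_ (Λ-++ F p p′) (Λ-++ F q q′) ⟨
      Λ F (p ++ p′) -ℤ Λ F (q ++ q′)          ≡⟨ Λ-−P F (p ++ p′) (q ++ q′) ⟨
      Λ F ((p ++ p′) −P (q ++ q′))            ∎) (ideal-++ {p −P q} {p′ −P q′} p−q∈I p′−q′∈I))
    where
    open ≡-Reasoning
    interchange : ∀ a b c d → (a -ℤ b) +ℤ (c -ℤ d) ≡ (a +ℤ c) -ℤ (b +ℤ d)
    interchange = solve-∀

  Λ-generator-multiple : ∀ (F : Monomial n → ℤ) c μ x y → let z = x ∧ y in
    Λ F (((c , μ) ∷ []) *P gen L x y) ≡
    c *ℤ ((F (μ ·ₘ[ x , y ]) -ℤ F (μ ·ₘ[ x , z ])) -ℤ (F (μ ·ₘ[ z , y ]) -ℤ F (μ ·ₘ[ z , z ])))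
  Λ-generator-multiple F c μ x y = expand c _ _ _ _
    where
    expand : ∀ c a b d e → (c *ℤ 1ℤ) *ℤ a +ℤ ((c *ℤ - 1ℤ) *ℤ b +ℤ ((c *ℤ - 1ℤ) *ℤ d +ℤ ((c *ℤ 1ℤ) *ℤ e +ℤ 0ℤ)))
                           ≡ c *ℤ ((a -ℤ b) -ℤ (d -ℤ e))
    expand = solve-∀

  straightening-relation : ∀ c μ x y → let z = x ∧ y in
    ((c , μ ·ₘ[ x , y ]) ∷ []) ≈I ((c , μ ·ₘ[ x , z ]) ∷ (c , μ ·ₘ[ z , y ]) ∷ (- c , μ ·ₘ[ z , z ]) ∷ [])
  straightening-relation c μ x y =
    congruent (ideal-transport multiple (lhs −P rhs) (λ F → trans (Λ-generator-multiple F c μ x y) (expand c _ _ _ _))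
                               (multiple∈ideal ((c , μ) ∷ []) x y))
    where
    z = x ∧ y
    multiple = ((c , μ) ∷ []) *P gen L x y
    lhs = (c , μ ·ₘ[ x , y ]) ∷ []
    rhs = (c , μ ·ₘ[ x , z ]) ∷ (c , μ ·ₘ[ z , y ]) ∷ (- c , μ ·ₘ[ z , z ]) ∷ []
    expand : ∀ c a b d e → c *ℤ ((a -ℤ b) -ℤ (d -ℤ e)) ≡ c *ℤ a +ℤ (- c *ℤ b +ℤ (- c *ℤ d +ℤ (- - c *ℤ e +ℤ 0ℤ)))
    expand = solve-∀

  Straightened : Poly n → Set
  Straightened p = Σ (Poly n) λ q → All (Standard L ∘ proj₂) q × p ≈I q

  straightened-++ : ∀ {p p′} → Straightened p → Straightened p′ → Straightened (p ++ p′)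
  straightened-++ (q , q-std , p≈q) (q′ , q′-std , p′≈q′) = q ++ q′ , ++⁺ q-std q′-std , ≈I-++ p≈q p′≈q′

  straightened-≈I : ∀ {p p′} → p ≈I p′ → Straightened p′ → Straightened p
  straightened-≈I p≈p′ (q , q-std , p′≈q) = q , q-std , ≈I-trans p≈p′ p′≈q

  straighten-term : ∀ c μ → Acc _<ℕ_ (weight rank μ) → Straightened ((c , μ) ∷ [])
  straighten-term c μ (acc lighter) with standard-or-incomparable μ
  ... | inj₁ μ-std = (c , μ) ∷ [] , μ-std ∷ [] , ≈I-refl ((c , μ) ∷ [])
  ... | inj₂ (x , y , μ[x]>0 , μ[y]>0 , x≰y , y≰x) with divide-varₘ² {μ = μ} μ[x]>0 μ[y]>0 (λ { refl → x≰y ≤-refl })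
  ...   | μ′ , refl = straightened-≈I (straightening-relation c μ′ x y) (straightened-++ xz (straightened-++ zy zz))
    where
    z = x ∧ y
    z<x = rank-meet-<ˡ x≰y
    z<y = rank-meet-<ʳ y≰x
    xz = straighten-term c     (μ′ ·ₘ[ x , z ]) (lighter (weight-·ₘ[]-< rank μ′ (ℕP.+-monoʳ-< (rank x) z<y)))
    zy = straighten-term c     (μ′ ·ₘ[ z , y ]) (lighter (weight-·ₘ[]-< rank μ′ (ℕP.+-monoˡ-< (rank y) z<x)))
    zz = straighten-term (- c) (μ′ ·ₘ[ z , z ]) (lighter (weight-·ₘ[]-< rank μ′ (ℕP.+-mono-< z<x z<y)))

  straighten : ∀ p → Straightened p
  straighten []            = [] , [] , ≈I-refl []
  straighten ((c , μ) ∷ p) = straightened-++ (straighten-term c μ (<-wellFounded (weight rank μ))) (straighten p)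

  spanning : ∀ p → Σ (Poly n) λ q → StandardCombination L q × InIdeal L (p −P q)
  spanning p = let q , q-std , congruent p−q∈I = straighten p in q , All-support q-std , p−q∈I

  straightening-law : ∀ x y → ¬ x ≤ y → ¬ y ≤ x →
                      Σ (Poly n) λ q → StandardCombination L q × InIdeal L ((h x *P h y) −P q) ×
                                       (∀ μ → coeff q μ ≢ 0ℤ → ∃ λ z → Contains L μ z × z < x × z < y)
  straightening-law x y x≰y y≰x = q , All-support q-std , _≈I_.difference∈ideal relation , All-support q-below
    where
    z = x ∧ y
    q = (1ℤ , varₘ x ·ₘ varₘ z) ∷ (1ℤ , varₘ z ·ₘ varₘ y) ∷ (- 1ℤ , varₘ z ·ₘ varₘ z) ∷ []
    q-std : All (Standard L ∘ proj₂) q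
    q-std = standard-varₘ² (inj₂ (x∧y≤x x y)) ∷ standard-varₘ² (inj₁ (x∧y≤y x y)) ∷ standard-varₘ² (inj₁ ≤-refl) ∷ []
    q-below : All ((λ μ → ∃ λ w → Contains L μ w × w < x × w < y) ∘ proj₂) q
    q-below = (z , varₘ²-containsʳ x z , meet-<ˡ x≰y , meet-<ʳ y≰x)
            ∷ (z , varₘ²-containsˡ z y , meet-<ˡ x≰y , meet-<ʳ y≰x)
            ∷ (z , varₘ²-containsˡ z z , meet-<ˡ x≰y , meet-<ʳ y≰x)
            ∷ []
    relation : ((1ℤ , varₘ x ·ₘ varₘ y) ∷ []) ≈I q
    relation = subst₂ _≈I_ (cong₂ _∷_ (unit-multiplier 1ℤ) refl)
                           (cong₂ _∷_ (unit-multiplier 1ℤ) (cong₂ _∷_ (unit-multiplier 1ℤ) (cong₂ _∷_ (unit-multiplier (- 1ℤ)) refl)))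
                           (straightening-relation 1ℤ (replicate n 0) x y)
      where
      unit-multiplier : ∀ c {ν} → (c , replicate n 0 ·ₘ ν) ≡ (c , ν)
      unit-multiplier c = cong (c ,_) (·ₘ-identityˡ _)

  Λ-rename-ideal : ∀ {m} (σ : Fin n → Fin m) → (∀ x y → σ (x ∧ y) ≡ σ x ⊎ σ (x ∧ y) ≡ σ y) →
                   ∀ (G : Monomial m → ℤ) p → InIdeal L p → Λ (G ∘ rename σ) p ≡ 0ℤ
  Λ-rename-ideal σ selects G p (cs , p≃Σ) = trans (Λ-cong F p (combination cs) p≃Σ) (vanishes cs)
    where
    F = G ∘ rename σ
    F-cong : ∀ μ {a b a′ b′} → σ a ≡ σ a′ → σ b ≡ σ b′ → F (μ ·ₘ[ a , b ]) ≡ F (μ ·ₘ[ a′ , b′ ])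
    F-cong μ σa≡σa′ σb≡σb′ = cong G (rename-·ₘ[]-cong σ μ σa≡σa′ σb≡σb′)
    term : ∀ c μ x y → Λ F (((c , μ) ∷ []) *P gen L x y) ≡ 0ℤ
    term c μ x y = trans (Λ-generator-multiple F c μ x y) (trans (cong (c *ℤ_) (bracket (selects x y))) (ℤP.*-zeroʳ c))
      where
      z = x ∧ y
      bracket : σ z ≡ σ x ⊎ σ z ≡ σ y →
                (F (μ ·ₘ[ x , y ]) -ℤ F (μ ·ₘ[ x , z ])) -ℤ (F (μ ·ₘ[ z , y ]) -ℤ F (μ ·ₘ[ z , z ])) ≡ 0ℤ
      bracket (inj₁ σz≡σx) = ℤP.i≡j⇒i-j≡0 (cong₂ _-ℤ_ (F-cong μ (sym σz≡σx) refl) (F-cong μ (sym σz≡σx) refl))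
      bracket (inj₂ σz≡σy) =
        cong₂ _-ℤ_ (ℤP.i≡j⇒i-j≡0 (F-cong μ refl (sym σz≡σy))) (ℤP.i≡j⇒i-j≡0 (F-cong μ refl (sym σz≡σy)))
    multiple : ∀ q x y → Λ F (q *P gen L x y) ≡ 0ℤ
    multiple []            x y = refl
    multiple ((c , μ) ∷ q) x y =
      trans (Λ-++ F (((c , μ) ∷ []) *P gen L x y) (q *P gen L x y)) (cong₂ _+ℤ_ (term c μ x y) (multiple q x y))
    vanishes : ∀ cs → Λ F (combination cs) ≡ 0ℤ
    vanishes []                  = refl
    vanishes ((q , x , y) ∷ cs) =
      trans (Λ-++ F (q *P gen L x y) (combination cs)) (cong₂ _+ℤ_ (multiple q x y) (vanishes cs))

  rank₀ : Fin (suc n) → ℕ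
  rank₀ zero    = 0
  rank₀ (suc x) = rank x

  module ChainFloor (μ : Monomial n) (μ-std : Standard L μ) where

    -- The index zero is a new bottom element, the floor of x when no variable of μ lies below x.
    data Floor (x : Fin n) : Fin (suc n) → Set where
      none : (∀ s → Contains L μ s → ¬ s ≤ x) → Floor x zero
      some : ∀ {m} → Contains L μ m → m ≤ x → (∀ s → Contains L μ s → s ≤ x → s ≤ m) → Floor x (suc m)

    below? : ∀ x → Decidable (λ s → Contains L μ s × s ≤ x)
    below? x s = (0 <?ℕ lookup μ s) ×-dec (s ≤? x)

    find-floor : ∀ x → ∃ (Floor x)
    find-floor x with greatest ≤-refl ≤-trans (below? x) (λ (cs , _) (ct , _) → μ-std _ _ cs ct) (allFin n)
    ... | inj₁ nothing-below         = zero , none λ s cs s≤x → All.lookup nothing-below (∈-allFin s) (cs , s≤x)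
    ... | inj₂ (m , (cm , m≤x) , up) = suc m , some cm m≤x λ s cs s≤x → All.lookup up (∈-allFin s) (cs , s≤x)

    floor : Fin n → Fin (suc n)
    floor x = proj₁ (find-floor x)

    floor-spec : ∀ x → Floor x (floor x)
    floor-spec x = proj₂ (find-floor x)

    Floor-∧ : ∀ {x y a b c} → Floor x a → Floor y b → Floor (x ∧ y) c → c ≡ a ⊎ c ≡ b
    Floor-∧ (none _)     _        (none _) = inj₁ refl
    Floor-∧ (some _ _ _) (none _) (none _) = inj₂ refl
    Floor-∧ (some ca a≤x _) (some cb b≤y _) (none nothing-below) with μ-std _ _ ca cb
    ... | inj₁ a≤b = ⊥-elim (nothing-below _ ca (∧-greatest a≤x (≤-trans a≤b b≤y)))
    ... | inj₂ b≤a = ⊥-elim (nothing-below _ cb (∧-greatest (≤-trans b≤a a≤x) b≤y))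
    Floor-∧ {x} {y} (none nothing-below) _ (some cm m≤x∧y _) =
      ⊥-elim (nothing-below _ cm (≤-trans m≤x∧y (x∧y≤x x y)))
    Floor-∧ {x} {y} (some _ _ _) (none nothing-below) (some cm m≤x∧y _) =
      ⊥-elim (nothing-below _ cm (≤-trans m≤x∧y (x∧y≤y x y)))
    Floor-∧ {x} {y} (some ca a≤x a-max) (some cb b≤y b-max) (some cm m≤x∧y m-max) with μ-std _ _ ca cb
    ... | inj₁ a≤b = inj₁ (cong suc (antisym (a-max _ cm (≤-trans m≤x∧y (x∧y≤x x y)))
                                             (m-max _ ca (∧-greatest a≤x (≤-trans a≤b b≤y)))))
    ... | inj₂ b≤a = inj₂ (cong suc (antisym (b-max _ cm (≤-trans m≤x∧y (x∧y≤y x y)))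
                                             (m-max _ cb (∧-greatest (≤-trans b≤a a≤x) b≤y))))

    floor-∧ : ∀ x y → floor (x ∧ y) ≡ floor x ⊎ floor (x ∧ y) ≡ floor y
    floor-∧ x y = Floor-∧ (floor-spec x) (floor-spec y) (floor-spec (x ∧ y))

    Floor-rank : ∀ {x a} → Floor x a → a ≡ suc x ⊎ rank₀ a <ℕ rank x
    Floor-rank {x}             (none _)       = inj₂ (rank-pos x)
    Floor-rank {x} {a = suc m} (some _ m≤x _) with m ≟ᶠ x
    ... | yes refl = inj₁ refl
    ... | no m≢x   = inj₂ (rank-strict m≤x m≢x)

    rank₀∘floor≤rank : ∀ x → rank₀ (floor x) ≤ℕ rank x
    rank₀∘floor≤rank x with Floor-rank (floor-spec x)
    ... | inj₁ floor[x]≡suc[x] = ℕP.≤-reflexive (cong rank₀ floor[x]≡suc[x])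
    ... | inj₂ floor-lower     = ℕP.<⇒≤ floor-lower

    Floor-support : ∀ {x a} → Contains L μ x → Floor x a → a ≡ suc x
    Floor-support μ[x]>0 (none nothing-below) = ⊥-elim (nothing-below _ μ[x]>0 ≤-refl)
    Floor-support μ[x]>0 (some _ m≤x m-max)   = cong suc (antisym m≤x (m-max _ μ[x]>0 ≤-refl))

    floor-fixes-support : ∀ x → Contains L μ x → floor x ≡ suc x
    floor-fixes-support x μ[x]>0 = Floor-support μ[x]>0 (floor-spec x)

    rename-floor-fixed : ∀ ν → (∀ x → 0 <ℕ lookup ν x → floor x ≡ suc x) → rename floor ν ≡ 0 ∷ ν
    rename-floor-fixed ν fixed = trans (rename-cong-support ν fixed) (rename-suc ν)

    fibre-weight : ∀ ν → rename floor ν ≡ rename floor μ → weight (rank₀ ∘ floor) ν ≡ weight rank μ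
    fibre-weight ν same-image = begin
      weight (rank₀ ∘ floor) ν       ≡⟨ weight-rename floor rank₀ ν ⟨
      weight rank₀ (rename floor ν)  ≡⟨ cong (weight rank₀) same-image ⟩
      weight rank₀ (rename floor μ)  ≡⟨ weight-rename floor rank₀ μ ⟩
      weight (rank₀ ∘ floor) μ       ≡⟨ weight-cong-support μ (λ x μ[x]>0 → cong rank₀ (floor-fixes-support x μ[x]>0)) ⟩
      weight rank μ                  ∎
      where open ≡-Reasoning

    fibre-lighter : ∀ ν → rename floor ν ≡ rename floor μ → weight rank ν ≤ℕ weight rank μ → ν ≡ μ
    fibre-lighter ν same-image ν-lighter = ∷-injectiveʳ (begin
      0 ∷ ν           ≡⟨ rename-floor-fixed ν floor-fixes-ν ⟨
      rename floor ν  ≡⟨ same-image ⟩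
      rename floor μ  ≡⟨ rename-floor-fixed μ floor-fixes-support ⟩
      0 ∷ μ           ∎)
      where
      open ≡-Reasoning
      floor-fixes-ν : ∀ x → 0 <ℕ lookup ν x → floor x ≡ suc x
      floor-fixes-ν x ν[x]>0 with Floor-rank (floor-spec x)
      ... | inj₁ fixed       = fixed
      ... | inj₂ floor-lower = ⊥-elim (ℕP.<-irrefl (fibre-weight ν same-image)
                                        (ℕP.<-≤-trans (weight-< ν x rank₀∘floor≤rank ν[x]>0 floor-lower) ν-lighter))

  heaviest-coeff-vanishes : ∀ q → StandardCombination L q → InIdeal L q → ∀ μ →
                            (∀ ν → coeff q ν ≢ 0ℤ → weight rank ν ≤ℕ weight rank μ) → coeff q μ ≢ 0ℤ → coeff q μ ≡ 0ℤ
  heaviest-coeff-vanishes q q-std q∈I μ heaviest q[μ]≢0 = begin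
    coeff q μ                                       ≡⟨ Λ-indicator q μ ⟨
    Λ (indicator μ) q                               ≡⟨ Λ-cong-support q same-fibre ⟩
    Λ (indicator (rename floor μ) ∘ rename floor) q  ≡⟨ Λ-rename-ideal floor floor-∧ (indicator (rename floor μ)) q q∈I ⟩
    0ℤ                                              ∎
    where
    open ≡-Reasoning
    open ChainFloor μ (q-std μ q[μ]≢0)
    same-fibre : ∀ ν → coeff q ν ≢ 0ℤ → indicator μ ν ≡ indicator (rename floor μ) (rename floor ν)
    same-fibre ν q[ν]≢0 with ≡-dec ℕP._≟_ ν μ | ≡-dec ℕP._≟_ (rename floor ν) (rename floor μ)
    ... | yes _    | yes _          = refl
    ... | yes refl | no ≢itself     = ⊥-elim (≢itself refl)
    ... | no ν≢μ   | yes same-image = ⊥-elim (ν≢μ (fibre-lighter ν same-image (heaviest ν q[ν]≢0)))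
    ... | no _     | no _           = refl

  independence : ∀ q → StandardCombination L q → InIdeal L q → q ≃ 0P
  independence q q-std q∈I m with coeff q m ℤ.≟ 0ℤ
  ... | yes q[m]≡0 = q[m]≡0
  ... | no q[m]≢0  =
    let μ , q[μ]≢0 , heaviest = heaviest-term (weight rank) q q[m]≢0
    in ⊥-elim (q[μ]≢0 (heaviest-coeff-vanishes q q-std q∈I μ heaviest q[μ]≢0))

theorem4p2 : (L : FiniteMeetSemilattice) → IsASL L
theorem4p2 L = record
  { spanning      = spanning
  ; independent   = independence
  ; straightening = straightening-law
  }
  where open AlgebraWithStraighteningLaw L
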